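{- Let $\mathbf a'=(a_1,a_2,a_3,a_4)\in(\mathbb{Z}\setminus\{0\})^4$ with $\gcd(a_i,a_j)=1$ for all $i\neq j$, and let $\mathbf d,\mathbf e\in\mathbb{Z}_{>0}^4$ with $\gcd(d_i,a_j)=1$ for all $i\ne j$ and $e_i\mid a_i$ for all $i$. Then $\mathscr{G}=\mathscr{G}(\mathbf a',\mathbf d,\mathbf e)$ is a full-rank sublattice of $\mathbb{Z}^3$, and it is described by congruence conditions $$a_{12}\equiv0\pmod{b_{12}},\qquad a_{23}\equiv\gamma_{23}\pmod{a_4b_{23}},\qquad a_{34}\equiv\gamma_{34}\pmod{a_1b_{34}},$$ i.e. $(a_{12},a_{23},a_{34})\in\mathbb{Z}^3$ lies in $\mathscr{G}$ if and only if these three congruences hold, for some integer $\gamma_{23}$ depending only on $\mathbf a',\mathbf d,\mathbf e$ and $a_{12}$, and some integer $\gamma_{34}$ depending only on $\mathbf a',\mathbf d,\mathbf e$ and $a_{12},a_{23}$.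
   Context: Given $(a_{12},a_{23},a_{34})$, define $a_{13}=(a_2a_{23}-a_4a_{34})/a_1$, $a_{24}=(a_3a_{23}-a_1a_{12})/a_4$, $a_{14}=(a_2a_3a_{23}-a_3a_4a_{34}-a_1a_2a_{12})/(a_1a_4)$. Let $f_{ij}=\mathrm{lcm}(d_i,d_j)e_ke_l$ where $\{k,l\}=\{1,2,3,4\}\setminus\{i,j\}$. $\mathscr{G}(\mathbf a',\mathbf d,\mathbf e)$ is the set of $(a_{12},a_{23},a_{34})\in\mathbb{Z}^3$ for which $a_{13},a_{24},a_{14}$ are integers and $f_{ij}\mid a_{ij}$ for all six pairs $\{i,j\}$. Further, $b_{12}=e_3e_4\,\mathrm{lcm}(d_1,d_2,\gcd(d_3,d_4))$, $b_{23}=e_1\,\mathrm{lcm}(d_2,d_3,d_4)$, $b_{34}=e_2\,\mathrm{lcm}(d_1,d_3,d_4)$. -}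

module Defs where

open import Data.Nat as ℕ using (ℕ)
open import Data.Nat.LCM using (lcm)
open import Data.Nat.GCD as ℕG using ()
open import Data.Integer using (ℤ; +_; _+_; _-_; _*_; -_)
open import Data.Integer.Divisibility using (_∣_)
open import Data.Integer.GCD using (gcd)
open import Data.Fin using (Fin)
open import Data.Fin.Patterns using (0F; 1F; 2F; 3F)
open import Data.Product using (Σ; _×_; _,_)
open import Relation.Binary.PropositionalEquality using (_≡_)

-- Indices 1,2,3,4 of the paper are 0F,1F,2F,3F here.

-- f_ij = lcm(d_i,d_j) e_k e_l, {k,l} the complement of {i,j}
f : (d e : Fin 4 → ℕ) → Fin 4 → Fin 4 → Fin 4 → Fin 4 → ℤ
f d e i j k l = + (lcm (d i) (d j) ℕ.* e k ℕ.* e l)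

-- Membership of (a12,a23,a34) in 𝒢(a',d,e): there are integers a13,a24,a14
-- with  a1 a13 = a2 a23 - a4 a34,  a4 a24 = a3 a23 - a1 a12,
-- a1 a4 a14 = a2 a3 a23 - a3 a4 a34 - a1 a2 a12  (i.e. the defining
-- quotients are integers, and then equal these witnesses since a1,a4 ≠ 0),
-- and f_ij ∣ a_ij for all six pairs.
InG : (a : Fin 4 → ℤ) (d e : Fin 4 → ℕ) (a12 a23 a34 : ℤ) → Set
InG a d e a12 a23 a34 =
  Σ ℤ λ a13 → Σ ℤ λ a24 → Σ ℤ λ a14 →
    (a 0F * a13 ≡ a 1F * a23 - a 3F * a34)
  × (a 3F * a24 ≡ a 2F * a23 - a 0F * a12)
  × (a 0F * a 3F * a14 ≡ a 1F * a 2F * a23 - a 2F * a 3F * a34 - a 0F * a 1F * a12)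
  × (f d e 0F 1F 2F 3F ∣ a12)
  × (f d e 1F 2F 0F 3F ∣ a23)
  × (f d e 2F 3F 0F 1F ∣ a34)
  × (f d e 0F 2F 1F 3F ∣ a13)
  × (f d e 1F 3F 0F 2F ∣ a24)
  × (f d e 0F 3F 1F 2F ∣ a14)

b12 : (d e : Fin 4 → ℕ) → ℤ
b12 d e = + (e 2F ℕ.* e 3F ℕ.* lcm (lcm (d 0F) (d 1F)) (ℕG.gcd (d 2F) (d 3F)))

b23 : (d e : Fin 4 → ℕ) → ℤ
b23 d e = + (e 0F ℕ.* lcm (lcm (d 1F) (d 2F)) (d 3F))

b34 : (d e : Fin 4 → ℕ) → ℤ
b34 d e = + (e 1F ℕ.* lcm (lcm (d 0F) (d 2F)) (d 3F))

det3 : (x1 y1 z1 x2 y2 z2 x3 y3 z3 : ℤ) → ℤ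
det3 x1 y1 z1 x2 y2 z2 x3 y3 z3 =
  x1 * (y2 * z3 - z2 * y3) - y1 * (x2 * z3 - z2 * x3) + z1 * (x2 * y3 - y2 * x3)

-- 𝒢 is cut out of ℤ³ by linear equations and divisibility conditions, so it is a
-- subgroup, and the congruences follow from an echelon basis: elements (b₁₂, *, *),
-- (0, a₄b₂₃, *), (0, 0, a₁b₃₄) of 𝒢, together with the facts that b₁₂ divides a₁₂ on all of 𝒢,
-- a₄b₂₃ divides a₂₃ when a₁₂ = 0, and a₁b₃₄ divides a₃₄ when a₁₂ = a₂₃ = 0.
-- These divisibilities come from the defining relations by Gauss's lemma: for a₁₂ = 0 the relation
-- a₄a₂₄ = a₃a₂₃ with gcd(a₃,a₄) = 1 and e₁ ∣ a₂₃ forces a₂₃ = a₄e₁w and a₂₄ = a₃e₁w, after which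
-- d₂, d₃ (dividing a₂₃) and d₄ (dividing a₂₄) must divide w; for a₁₂ the extra factor
-- g = gcd(d₃,d₄) divides a₃a₂₃ - a₄a₂₄ = a₁a₁₂. The first basis vector is a Bézout combination
-- of (W e₃a₄, 0, 0) and (W′a₃e₄, W′a₁e₄, 0), where W = M d₄/g, W′ = M d₃/g, M = lcm(d₁,d₂,g):
-- their first coordinates have gcd exactly e₃e₄M = b₁₂.

module Submission where

open import Defs
open import Data.Nat as ℕ using (ℕ)
open import Data.Integer using (ℤ; +_; _+_; _-_; _*_; -_)
open import Data.Integer.Divisibility using (_∣_)
open import Data.Integer.GCD using (gcd)
open import Data.Fin using (Fin)
open import Data.Fin.Patterns using (0F; 3F)
open import Data.Product using (Σ; _×_; _,_; proj₁; proj₂)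
open import Function.Bundles using (_⇔_; mk⇔; module Equivalence)
open import Relation.Binary.PropositionalEquality using (_≡_; _≢_)

open import Data.Fin.Patterns using (1F; 2F)
open import Data.Integer using (0ℤ; 1ℤ; -1ℤ; ∣_∣; NonZero)
open import Data.Integer.Base using (≢-nonZero)
open import Data.Integer.Divisibility.Signed as Signed using (divides; _∣?_) renaming (_∣_ to _∣ₛ_)
open import Data.Integer.Properties
  using (+-comm; *-comm; *-assoc; *-identityˡ; *-identityʳ; *-cancelˡ-≡; neg-distribˡ-*; -1*i≡-i; pos-*; pos-+; i*j≡0⇒i≡0∨j≡0)
open import Data.Integer.Tactic.RingSolver using (solve)
open import Data.List using ([]; _∷_)
import Data.Nat.Coprimality as ℕC
import Data.Nat.Divisibility as ℕD
open import Data.Nat.GCD as ℕG using (module Bézout)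
open import Data.Nat.DivMod using (m*[n/m]≡n)
open import Data.Nat.LCM using (lcm; lcm-least; m∣lcm[m,n]; n∣lcm[m,n]; gcd*lcm)
import Data.Nat.Properties as ℕP
open import Data.Sum using ([_,_]′; inj₁)
open import Function using (_∘_)
open import Relation.Binary.PropositionalEquality using (refl; sym; trans; cong; cong₂; subst; subst₂; module ≡-Reasoning)
open import Relation.Nullary using (yes; no; contradiction)

open ≡-Reasoning

-- Coprimality in Bézout form. Unlike Data.Integer.Coprimality.Coprime it does not pass through ∣_∣,
-- so its arguments can be inferred by unification.
Comaximal : ℤ → ℤ → Set
Comaximal x y = Σ ℤ λ r → Σ ℤ λ s → r * x + s * y ≡ 1ℤ

comaximal-sym : ∀ {x y} → Comaximal x y → Comaximal y x
comaximal-sym {x} {y} (r , s , eq) = s , r , trans (+-comm (s * y) (r * x)) eq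

comaximal-*ʳ : ∀ {x y z} → Comaximal x y → Comaximal x z → Comaximal x (y * z)
comaximal-*ʳ {x} {y} {z} (r₁ , s₁ , eq₁) (r₂ , s₂ , eq₂) =
  r₁ * r₂ * x + r₁ * s₂ * z + s₁ * y * r₂ , s₁ * s₂ , (begin
    (r₁ * r₂ * x + r₁ * s₂ * z + s₁ * y * r₂) * x + s₁ * s₂ * (y * z)
      ≡⟨ solve (r₁ ∷ s₁ ∷ r₂ ∷ s₂ ∷ x ∷ y ∷ z ∷ []) ⟩
    (r₁ * x + s₁ * y) * (r₂ * x + s₂ * z)
      ≡⟨ cong₂ _*_ eq₁ eq₂ ⟩
    1ℤ ∎)

comaximal-*ˡ : ∀ {x y z} → Comaximal x z → Comaximal y z → Comaximal (x * y) z
comaximal-*ˡ c c′ = comaximal-sym (comaximal-*ʳ (comaximal-sym c) (comaximal-sym c′))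

comaximal-∣ʳ : ∀ {x y y′} → y ∣ₛ y′ → Comaximal x y′ → Comaximal x y
comaximal-∣ʳ {x} {y} (divides q refl) (r , s , eq) =
  r , s * q , trans (cong (λ t → r * x + t) (*-assoc s q y)) eq

comaximal-∣ˡ : ∀ {x x′ y} → x ∣ₛ x′ → Comaximal x′ y → Comaximal x y
comaximal-∣ˡ x∣x′ c = comaximal-sym (comaximal-∣ʳ x∣x′ (comaximal-sym c))

comaximal-divisor : ∀ {k c w} → Comaximal k c → k ∣ₛ c * w → k ∣ₛ w
comaximal-divisor {k} {c} {w} (r , s , eq) k∣cw =
  subst (k ∣ₛ_) w≡ (Signed.∣m∣n⇒∣m+n (divides (r * w) refl) (Signed.∣n⇒∣m*n s k∣cw))
  where
  w≡ : r * w * k + s * (c * w) ≡ w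
  w≡ = begin
    r * w * k + s * (c * w) ≡⟨ solve (r ∷ s ∷ k ∷ c ∷ w ∷ []) ⟩
    (r * k + s * c) * w     ≡⟨ cong (_* w) eq ⟩
    1ℤ * w                  ≡⟨ *-identityˡ w ⟩
    w                       ∎

ℕ-bézout⇒comaximal : ∀ {m n x y} → 1 ℕ.+ y ℕ.* n ≡ x ℕ.* m → Comaximal (+ m) (+ n)
ℕ-bézout⇒comaximal {m} {n} {x} {y} eq = + x , - + y , (begin
  + x * + m + - + y * + n     ≡⟨ cong (λ u → + x * + m + u) (sym (neg-distribˡ-* (+ y) (+ n))) ⟩
  + x * + m - + y * + n       ≡⟨ cong₂ _-_ (sym (pos-* x m)) (sym (pos-* y n)) ⟩
  + (x ℕ.* m) - + (y ℕ.* n)   ≡⟨ cong (λ u → + u - + (y ℕ.* n)) (sym eq) ⟩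
  + (1 ℕ.+ y ℕ.* n) - + (y ℕ.* n) ≡⟨ cong (_- + (y ℕ.* n)) (pos-+ 1 (y ℕ.* n)) ⟩
  1ℤ + + (y ℕ.* n) - + (y ℕ.* n) ≡⟨ 1+i-i≡1 (+ (y ℕ.* n)) ⟩
  1ℤ                          ∎)
  where
  1+i-i≡1 : ∀ i → 1ℤ + i - i ≡ 1ℤ
  1+i-i≡1 i = solve (i ∷ [])

bézout⇒comaximal : ∀ {m n} → Bézout.Identity 1 m n → Comaximal (+ m) (+ n)
bézout⇒comaximal (Bézout.+- x y eq) = ℕ-bézout⇒comaximal {x = x} {y} eq
bézout⇒comaximal (Bézout.-+ x y eq) = comaximal-sym (ℕ-bézout⇒comaximal {x = y} {x} eq)

gcd≡1⇒comaximal : ∀ i j → gcd i j ≡ + 1 → Comaximal i j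
gcd≡1⇒comaximal i j gcd≡1 =
  comaximal-∣ˡ (Signed.m∣∣m∣ {i}) (comaximal-∣ʳ (Signed.m∣∣m∣ {j})
    (bézout⇒comaximal (ℕC.coprime-Bézout (ℕC.gcd≡1⇒coprime (cong ∣_∣ gcd≡1)))))

comaximal-cross : ∀ {A B E u v} .{{_ : NonZero A}} → A * u ≡ B * v → Comaximal A B → Comaximal E A → E ∣ₛ v →
                  Σ ℤ λ w → v ≡ A * (E * w) × u ≡ B * (E * w)
comaximal-cross {A} {B} {E} {u} {v} Au≡Bv A⊥B E⊥A E∣v
  with comaximal-divisor A⊥B (divides u (trans (sym Au≡Bv) (*-comm A u)))
... | divides t v≡tA with comaximal-divisor E⊥A (subst (E ∣ₛ_) (trans v≡tA (*-comm t A)) E∣v)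
... | divides w t≡wE = w , v≡ , u≡
  where
  v≡ : v ≡ A * (E * w)
  v≡ = begin
    v           ≡⟨ v≡tA ⟩
    t * A       ≡⟨ cong (_* A) t≡wE ⟩
    w * E * A   ≡⟨ solve (w ∷ E ∷ A ∷ []) ⟩
    A * (E * w) ∎
  u≡ : u ≡ B * (E * w)
  u≡ = *-cancelˡ-≡ A u (B * (E * w)) (begin
    A * u             ≡⟨ Au≡Bv ⟩
    B * v             ≡⟨ cong (B *_) v≡ ⟩
    B * (A * (E * w)) ≡⟨ solve (A ∷ B ∷ E ∷ w ∷ []) ⟩
    A * (B * (E * w)) ∎)

m∣lcm[m,n]*p*q : ∀ m n p q → m ℕD.∣ lcm m n ℕ.* p ℕ.* q
m∣lcm[m,n]*p*q m n p q = ℕD.∣m⇒∣m*n q (ℕD.∣m⇒∣m*n p (m∣lcm[m,n] m n))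

n∣lcm[m,n]*p*q : ∀ m n p q → n ℕD.∣ lcm m n ℕ.* p ℕ.* q
n∣lcm[m,n]*p*q m n p q = ℕD.∣m⇒∣m*n q (ℕD.∣m⇒∣m*n p (n∣lcm[m,n] m n))

p∣lcm[m,n]*p*q : ∀ m n p q → p ℕD.∣ lcm m n ℕ.* p ℕ.* q
p∣lcm[m,n]*p*q m n p q = ℕD.n∣m*n*o (lcm m n) q

q∣lcm[m,n]*p*q : ∀ m n p q → q ℕD.∣ lcm m n ℕ.* p ℕ.* q
q∣lcm[m,n]*p*q m n p q = ℕD.n∣m*n (lcm m n ℕ.* p)

pos-∣ : ∀ {m n} → m ℕD.∣ n → + m ∣ₛ + n
pos-∣ {m} {n} = Signed.∣ᵤ⇒∣ {+ m} {+ n}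

lcm-least-pos : ∀ {m n w} → + m ∣ₛ w → + n ∣ₛ w → + lcm m n ∣ₛ w
lcm-least-pos {m} {n} {w} m∣w n∣w = Signed.∣ᵤ⇒∣ {+ lcm m n} {w} (lcm-least (Signed.∣⇒∣ᵤ m∣w) (Signed.∣⇒∣ᵤ n∣w))

*-pres-∣ₛ : ∀ {i j k l} → i ∣ₛ j → k ∣ₛ l → i * k ∣ₛ j * l
*-pres-∣ₛ {i} {k = k} (divides p refl) (divides q refl) =
  divides (p * q) (solve (p ∷ q ∷ i ∷ k ∷ []))

lcm*-∣ : ∀ {m n p q w u v} → + m ∣ₛ w → + n ∣ₛ w → + p ∣ₛ u → + q ∣ₛ v →
         + (lcm m n ℕ.* p ℕ.* q) ∣ₛ w * u * v
lcm*-∣ {m} {n} {p} {q} m∣w n∣w p∣u q∣v =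
  subst (_∣ₛ _) (sym (trans (pos-* (lcm m n ℕ.* p) q) (cong (_* + q) (pos-* (lcm m n) p))))
    (*-pres-∣ₛ (*-pres-∣ₛ (lcm-least-pos m∣w n∣w) p∣u) q∣v)

m∣lcm₃ : ∀ m n o → m ℕD.∣ lcm (lcm m n) o
m∣lcm₃ m n o = ℕD.∣-trans (m∣lcm[m,n] m n) (m∣lcm[m,n] (lcm m n) o)

n∣lcm₃ : ∀ m n o → n ℕD.∣ lcm (lcm m n) o
n∣lcm₃ m n o = ℕD.∣-trans (n∣lcm[m,n] m n) (m∣lcm[m,n] (lcm m n) o)

o∣lcm₃ : ∀ m n o → o ℕD.∣ lcm (lcm m n) o
o∣lcm₃ m n o = n∣lcm[m,n] (lcm m n) o

pos≢0 : ∀ {n} → n ≢ 0 → + n ≢ 0ℤ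
pos≢0 n≢0 = n≢0 ∘ cong ∣_∣

m*n≢0 : ∀ {m n} → m ≢ 0 → n ≢ 0 → m ℕ.* n ≢ 0
m*n≢0 {m} m≢0 n≢0 mn≡0 = [ m≢0 , n≢0 ]′ (ℕP.m*n≡0⇒m≡0∨n≡0 m mn≡0)

i*j≢0 : ∀ {i j} → i ≢ 0ℤ → j ≢ 0ℤ → i * j ≢ 0ℤ
i*j≢0 {i} i≢0 j≢0 ij≡0 = [ i≢0 , j≢0 ]′ (i*j≡0⇒i≡0∨j≡0 i ij≡0)

lcm≢0 : ∀ {m n} → m ≢ 0 → n ≢ 0 → lcm m n ≢ 0
lcm≢0 {m} {n} m≢0 n≢0 lcm≡0 = m*n≢0 m≢0 n≢0 (begin
  m ℕ.* n                        ≡⟨ sym (gcd*lcm m n) ⟩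
  ℕG.gcd m n ℕ.* lcm m n         ≡⟨ cong (ℕG.gcd m n ℕ.*_) lcm≡0 ⟩
  ℕG.gcd m n ℕ.* 0               ≡⟨ ℕP.*-zeroʳ (ℕG.gcd m n) ⟩
  0                              ∎)

det3-upper-triangular≢0 : ∀ x₁ y₁ z₁ y₂ z₂ z₃ → x₁ ≢ 0ℤ → y₂ ≢ 0ℤ → z₃ ≢ 0ℤ →
                          det3 x₁ y₁ z₁ 0ℤ y₂ z₂ 0ℤ 0ℤ z₃ ≢ 0ℤ
det3-upper-triangular≢0 x₁ y₁ z₁ y₂ z₂ z₃ x₁≢0 y₂≢0 z₃≢0 det≡0 =
  i*j≢0 (i*j≢0 x₁≢0 y₂≢0) z₃≢0 (trans (sym det≡x₁y₂z₃) det≡0)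
  where
  det≡x₁y₂z₃ : det3 x₁ y₁ z₁ 0ℤ y₂ z₂ 0ℤ 0ℤ z₃ ≡ x₁ * y₂ * z₃
  det≡x₁y₂z₃ = begin
    x₁ * (y₂ * z₃ - z₂ * 0ℤ) - y₁ * (0ℤ * z₃ - z₂ * 0ℤ) + z₁ * (0ℤ * 0ℤ - y₂ * 0ℤ)
      ≡⟨ solve (x₁ ∷ y₁ ∷ z₁ ∷ y₂ ∷ z₂ ∷ z₃ ∷ []) ⟩
    x₁ * y₂ * z₃ ∎

-- Exact division, with junk value 0 when k ∤ i.
_÷_ : ℤ → ℤ → ℤ
i ÷ k with k ∣? i
... | yes k∣i = Signed.quotient k∣i
... | no  _   = 0ℤ

i÷k*k≡i : ∀ {k i} → k ∣ₛ i → (i ÷ k) * k ≡ i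
i÷k*k≡i {k} {i} k∣i with k ∣? i
... | yes (divides q i≡qk) = sym i≡qk
... | no  k∤i              = contradiction k∣i k∤i

module Echelon
  (P : ℤ → ℤ → ℤ → Set)
  (P-+ : ∀ {x y z x′ y′ z′} → P x y z → P x′ y′ z′ → P (x + x′) (y + y′) (z + z′))
  (P-* : ∀ n {x y z} → P x y z → P (n * x) (n * y) (n * z))
  {B₁ y₁ z₁ B₂ z₂ B₃ : ℤ}
  (v₁ : P B₁ y₁ z₁) (v₂ : P 0ℤ B₂ z₂) (v₃ : P 0ℤ 0ℤ B₃)
  (B₁∣ : ∀ {x y z} → P x y z → B₁ ∣ₛ x)
  (B₂∣ : ∀ {y z} → P 0ℤ y z → B₂ ∣ₛ y)
  (B₃∣ : ∀ {z} → P 0ℤ 0ℤ z → B₃ ∣ₛ z)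
  where

  -- The multiples of v₁ and v₂ that clear the first two coordinates.
  γ₂₃ : ℤ → ℤ
  γ₂₃ x = (x ÷ B₁) * y₁

  γ₃₄ : ℤ → ℤ → ℤ
  γ₃₄ x y = (x ÷ B₁) * z₁ + ((y - γ₂₃ x) ÷ B₂) * z₂

  private
    P-resp : ∀ {x y z x′ y′ z′} → x ≡ x′ → y ≡ y′ → z ≡ z′ → P x y z → P x′ y′ z′
    P-resp refl refl refl p = p

    P-sub : ∀ n {x y z x′ y′ z′} → P x y z → P x′ y′ z′ → P (x - n * x′) (y - n * y′) (z - n * z′)
    P-sub n {x} {y} {z} {x′} {y′} {z′} p p′ =
      P-resp (i+-n*j≡i-n*j x x′) (i+-n*j≡i-n*j y y′) (i+-n*j≡i-n*j z z′) (P-+ p (P-* (- n) p′))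
      where
      i+-n*j≡i-n*j : ∀ i j → i + - n * j ≡ i - n * j
      i+-n*j≡i-n*j i j = solve (i ∷ j ∷ n ∷ [])

    i≡j⇒i-j≡0 : ∀ i j → i ≡ j → i - j ≡ 0ℤ
    i≡j⇒i-j≡0 i j refl = solve (i ∷ [])

    i-j-k≡i-[j+k] : ∀ i j k → i - j - k ≡ i - (j + k)
    i-j-k≡i-[j+k] i j k = solve (i ∷ j ∷ k ∷ [])

    0-i*0≡0 : ∀ i → 0ℤ - i * 0ℤ ≡ 0ℤ
    0-i*0≡0 i = solve (i ∷ [])

    i+j*0≡i : ∀ i j → i + j * 0ℤ ≡ i
    i+j*0≡i i j = solve (i ∷ j ∷ [])

    i+[j-i]≡j : ∀ i j → i + (j - i) ≡ j
    i+[j-i]≡j i j = solve (i ∷ j ∷ [])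

  congruences : ∀ x y z → P x y z ⇔ ((B₁ ∣ x) × (B₂ ∣ y - γ₂₃ x) × (B₃ ∣ z - γ₃₄ x y))
  congruences x y z = mk⇔ necessary sufficient
    where
    q r : ℤ
    q = x ÷ B₁
    r = (y - γ₂₃ x) ÷ B₂

    necessary : P x y z → (B₁ ∣ x) × (B₂ ∣ y - γ₂₃ x) × (B₃ ∣ z - γ₃₄ x y)
    necessary p = Signed.∣⇒∣ᵤ B₁∣x , Signed.∣⇒∣ᵤ (B₂∣ p₁) , Signed.∣⇒∣ᵤ (B₃∣ p₂)
      where
      B₁∣x : B₁ ∣ₛ x
      B₁∣x = B₁∣ p
      p₁ : P 0ℤ (y - γ₂₃ x) (z - q * z₁)
      p₁ = P-resp (i≡j⇒i-j≡0 x (q * B₁) (sym (i÷k*k≡i B₁∣x))) refl refl (P-sub q p v₁)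
      p₂ : P 0ℤ 0ℤ (z - γ₃₄ x y)
      p₂ = P-resp (0-i*0≡0 r) (i≡j⇒i-j≡0 (y - γ₂₃ x) (r * B₂) (sym (i÷k*k≡i (B₂∣ p₁)))) (i-j-k≡i-[j+k] z (q * z₁) (r * z₂))
             (P-sub r p₁ v₂)

    sufficient : (B₁ ∣ x) × (B₂ ∣ y - γ₂₃ x) × (B₃ ∣ z - γ₃₄ x y) → P x y z
    sufficient (B₁∣x , B₂∣y′ , B₃∣z′) =
      P-resp x≡ y≡ z≡ (P-+ (P-+ (P-* q v₁) (P-* r v₂)) (P-* s v₃))
      where
      s : ℤ
      s = (z - γ₃₄ x y) ÷ B₃
      x≡ : q * B₁ + r * 0ℤ + s * 0ℤ ≡ x
      x≡ = begin
        q * B₁ + r * 0ℤ + s * 0ℤ    ≡⟨ i+j*0≡i _ s ⟩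
        q * B₁ + r * 0ℤ             ≡⟨ i+j*0≡i _ r ⟩
        q * B₁                      ≡⟨ i÷k*k≡i (Signed.∣ᵤ⇒∣ {B₁} {x} B₁∣x) ⟩
        x                           ∎
      y≡ : q * y₁ + r * B₂ + s * 0ℤ ≡ y
      y≡ = begin
        q * y₁ + r * B₂ + s * 0ℤ    ≡⟨ i+j*0≡i _ s ⟩
        q * y₁ + r * B₂             ≡⟨ cong (λ t → q * y₁ + t) (i÷k*k≡i (Signed.∣ᵤ⇒∣ {B₂} {y - γ₂₃ x} B₂∣y′)) ⟩
        q * y₁ + (y - q * y₁)       ≡⟨ i+[j-i]≡j (q * y₁) y ⟩
        y                           ∎
      z≡ : q * z₁ + r * z₂ + s * B₃ ≡ z
      z≡ = begin
        q * z₁ + r * z₂ + s * B₃    ≡⟨ cong (λ t → q * z₁ + r * z₂ + t) (i÷k*k≡i (Signed.∣ᵤ⇒∣ {B₃} {z - γ₃₄ x y} B₃∣z′)) ⟩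
        γ₃₄ x y + (z - γ₃₄ x y)     ≡⟨ i+[j-i]≡j (γ₃₄ x y) z ⟩
        z                           ∎

-- InG a d e is definitionally 𝒢 _∣_ a d e; the proof works with signed divisibility, 𝒢 _∣ₛ_.
𝒢 : (ℤ → ℤ → Set) → (a : Fin 4 → ℤ) (d e : Fin 4 → ℕ) (a12 a23 a34 : ℤ) → Set
𝒢 _≼_ a d e a12 a23 a34 =
  Σ ℤ λ a13 → Σ ℤ λ a24 → Σ ℤ λ a14 →
    (a 0F * a13 ≡ a 1F * a23 - a 3F * a34)
  × (a 3F * a24 ≡ a 2F * a23 - a 0F * a12)
  × (a 0F * a 3F * a14 ≡ a 1F * a 2F * a23 - a 2F * a 3F * a34 - a 0F * a 1F * a12)
  × (f d e 0F 1F 2F 3F ≼ a12)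
  × (f d e 1F 2F 0F 3F ≼ a23)
  × (f d e 2F 3F 0F 1F ≼ a34)
  × (f d e 0F 2F 1F 3F ≼ a13)
  × (f d e 1F 3F 0F 2F ≼ a24)
  × (f d e 0F 3F 1F 2F ≼ a14)

𝒢-map : ∀ {R R′ : ℤ → ℤ → Set} {a d e x y z} → (∀ {k i} → R k i → R′ k i) → 𝒢 R a d e x y z → 𝒢 R′ a d e x y z
𝒢-map g (a13 , a24 , a14 , eq₁ , eq₂ , eq₃ , h₁ , h₂ , h₃ , h₄ , h₅ , h₆) =
  a13 , a24 , a14 , eq₁ , eq₂ , eq₃ , g h₁ , g h₂ , g h₃ , g h₄ , g h₅ , g h₆

private
  linear₂-+ : ∀ A B C D E F B′ D′ F′ → A * B ≡ C * D - E * F → A * B′ ≡ C * D′ - E * F′ →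
              A * (B + B′) ≡ C * (D + D′) - E * (F + F′)
  linear₂-+ A B C D E F B′ D′ F′ eq eq′ = begin
    A * (B + B′)                          ≡⟨ solve (A ∷ B ∷ B′ ∷ []) ⟩
    A * B + A * B′                        ≡⟨ cong₂ _+_ eq eq′ ⟩
    (C * D - E * F) + (C * D′ - E * F′)   ≡⟨ solve (C ∷ D ∷ E ∷ F ∷ D′ ∷ F′ ∷ []) ⟩
    C * (D + D′) - E * (F + F′)           ∎

  linear₂-* : ∀ n A B C D E F → A * B ≡ C * D - E * F → A * (n * B) ≡ C * (n * D) - E * (n * F)
  linear₂-* n A B C D E F eq = begin
    A * (n * B)           ≡⟨ solve (A ∷ B ∷ n ∷ []) ⟩
    n * (A * B)           ≡⟨ cong (n *_) eq ⟩
    n * (C * D - E * F)   ≡⟨ solve (C ∷ D ∷ E ∷ F ∷ n ∷ []) ⟩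
    C * (n * D) - E * (n * F) ∎

  linear₃-+ : ∀ A B C D E F G H B′ D′ F′ H′ →
              A * B ≡ C * D - E * F - G * H → A * B′ ≡ C * D′ - E * F′ - G * H′ →
              A * (B + B′) ≡ C * (D + D′) - E * (F + F′) - G * (H + H′)
  linear₃-+ A B C D E F G H B′ D′ F′ H′ eq eq′ = begin
    A * (B + B′)                                     ≡⟨ solve (A ∷ B ∷ B′ ∷ []) ⟩
    A * B + A * B′                                   ≡⟨ cong₂ _+_ eq eq′ ⟩
    (C * D - E * F - G * H) + (C * D′ - E * F′ - G * H′)
      ≡⟨ solve (C ∷ D ∷ E ∷ F ∷ G ∷ H ∷ D′ ∷ F′ ∷ H′ ∷ []) ⟩
    C * (D + D′) - E * (F + F′) - G * (H + H′)       ∎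

  linear₃-* : ∀ n A B C D E F G H → A * B ≡ C * D - E * F - G * H →
              A * (n * B) ≡ C * (n * D) - E * (n * F) - G * (n * H)
  linear₃-* n A B C D E F G H eq = begin
    A * (n * B)                   ≡⟨ solve (A ∷ B ∷ n ∷ []) ⟩
    n * (A * B)                   ≡⟨ cong (n *_) eq ⟩
    n * (C * D - E * F - G * H)   ≡⟨ solve (C ∷ D ∷ E ∷ F ∷ G ∷ H ∷ n ∷ []) ⟩
    C * (n * D) - E * (n * F) - G * (n * H) ∎

module _ (a : Fin 4 → ℤ) (d e : Fin 4 → ℕ) where

  InG⇔𝒢ₛ : ∀ {x y z} → InG a d e x y z ⇔ 𝒢 _∣ₛ_ a d e x y z
  InG⇔𝒢ₛ {x} {y} {z} =
    mk⇔ (𝒢-map {_∣_} {_∣ₛ_} {a} {d} {e} {x} {y} {z} Signed.∣ᵤ⇒∣) (𝒢-map {_∣ₛ_} {_∣_} {a} {d} {e} {x} {y} {z} Signed.∣⇒∣ᵤ)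

  𝒢ₛ-+ : ∀ {x y z x′ y′ z′} → 𝒢 _∣ₛ_ a d e x y z → 𝒢 _∣ₛ_ a d e x′ y′ z′ →
         𝒢 _∣ₛ_ a d e (x + x′) (y + y′) (z + z′)
  𝒢ₛ-+ {x} {y} {z} {x′} {y′} {z′}
       (a13 , a24 , a14 , eq₁ , eq₂ , eq₃ , h₁ , h₂ , h₃ , h₄ , h₅ , h₆)
       (b13 , b24 , b14 , eq₁′ , eq₂′ , eq₃′ , h₁′ , h₂′ , h₃′ , h₄′ , h₅′ , h₆′) =
    a13 + b13 , a24 + b24 , a14 + b14 ,
    linear₂-+ (a 0F) a13 (a 1F) y (a 3F) z b13 y′ z′ eq₁ eq₁′ ,
    linear₂-+ (a 3F) a24 (a 2F) y (a 0F) x b24 y′ x′ eq₂ eq₂′ ,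
    linear₃-+ (a 0F * a 3F) a14 (a 1F * a 2F) y (a 2F * a 3F) z (a 0F * a 1F) x b14 y′ z′ x′ eq₃ eq₃′ ,
    Signed.∣m∣n⇒∣m+n h₁ h₁′ , Signed.∣m∣n⇒∣m+n h₂ h₂′ , Signed.∣m∣n⇒∣m+n h₃ h₃′ ,
    Signed.∣m∣n⇒∣m+n h₄ h₄′ , Signed.∣m∣n⇒∣m+n h₅ h₅′ , Signed.∣m∣n⇒∣m+n h₆ h₆′

  𝒢ₛ-* : ∀ n {x y z} → 𝒢 _∣ₛ_ a d e x y z → 𝒢 _∣ₛ_ a d e (n * x) (n * y) (n * z)
  𝒢ₛ-* n {x} {y} {z} (a13 , a24 , a14 , eq₁ , eq₂ , eq₃ , h₁ , h₂ , h₃ , h₄ , h₅ , h₆) =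
    n * a13 , n * a24 , n * a14 ,
    linear₂-* n (a 0F) a13 (a 1F) y (a 3F) z eq₁ ,
    linear₂-* n (a 3F) a24 (a 2F) y (a 0F) x eq₂ ,
    linear₃-* n (a 0F * a 3F) a14 (a 1F * a 2F) y (a 2F * a 3F) z (a 0F * a 1F) x eq₃ ,
    Signed.∣n⇒∣m*n n h₁ , Signed.∣n⇒∣m*n n h₂ , Signed.∣n⇒∣m*n n h₃ ,
    Signed.∣n⇒∣m*n n h₄ , Signed.∣n⇒∣m*n n h₅ , Signed.∣n⇒∣m*n n h₆

  𝒢ₛ-resp : ∀ {x y z x′ y′ z′} → x ≡ x′ → y ≡ y′ → z ≡ z′ → 𝒢 _∣ₛ_ a d e x y z → 𝒢 _∣ₛ_ a d e x′ y′ z′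
  𝒢ₛ-resp refl refl refl p = p

  𝒢ₛ-neg : ∀ {x y z} → 𝒢 _∣ₛ_ a d e x y z → 𝒢 _∣ₛ_ a d e (- x) (- y) (- z)
  𝒢ₛ-neg {x} {y} {z} p = 𝒢ₛ-resp (-1*i≡-i x) (-1*i≡-i y) (-1*i≡-i z) (𝒢ₛ-* -1ℤ p)

x-axis-relations : ∀ a₁ a₂ a₃ a₄ W ε →
    a₁ * 0ℤ ≡ a₂ * 0ℤ - a₄ * 0ℤ
  × a₄ * - (W * a₁ * ε) ≡ a₃ * 0ℤ - a₁ * (W * ε * a₄)
  × a₁ * a₄ * - (W * a₂ * ε) ≡ a₂ * a₃ * 0ℤ - a₃ * a₄ * 0ℤ - a₁ * a₂ * (W * ε * a₄)
x-axis-relations a₁ a₂ a₃ a₄ W ε =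
  solve (a₁ ∷ a₂ ∷ a₄ ∷ []) , solve (a₁ ∷ a₃ ∷ a₄ ∷ W ∷ ε ∷ []) , solve (a₁ ∷ a₂ ∷ a₃ ∷ a₄ ∷ W ∷ ε ∷ [])

xy-plane-relations : ∀ a₁ a₂ a₃ a₄ W ε →
    a₁ * (W * a₂ * ε) ≡ a₂ * (W * a₁ * ε) - a₄ * 0ℤ
  × a₄ * 0ℤ ≡ a₃ * (W * a₁ * ε) - a₁ * (W * a₃ * ε)
  × a₁ * a₄ * 0ℤ ≡ a₂ * a₃ * (W * a₁ * ε) - a₃ * a₄ * 0ℤ - a₁ * a₂ * (W * a₃ * ε)
xy-plane-relations a₁ a₂ a₃ a₄ W ε =
  solve (a₁ ∷ a₂ ∷ a₄ ∷ W ∷ ε ∷ []) , solve (a₁ ∷ a₃ ∷ a₄ ∷ W ∷ ε ∷ []) , solve (a₁ ∷ a₂ ∷ a₃ ∷ a₄ ∷ W ∷ ε ∷ [])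

yz-plane-relations : ∀ a₁ a₂ a₃ a₄ W ε →
    a₁ * 0ℤ ≡ a₂ * (W * ε * a₄) - a₄ * (W * ε * a₂)
  × a₄ * (W * ε * a₃) ≡ a₃ * (W * ε * a₄) - a₁ * 0ℤ
  × a₁ * a₄ * 0ℤ ≡ a₂ * a₃ * (W * ε * a₄) - a₃ * a₄ * (W * ε * a₂) - a₁ * a₂ * 0ℤ
yz-plane-relations a₁ a₂ a₃ a₄ W ε =
  solve (a₁ ∷ a₂ ∷ a₄ ∷ W ∷ ε ∷ []) , solve (a₁ ∷ a₃ ∷ a₄ ∷ W ∷ ε ∷ []) , solve (a₁ ∷ a₂ ∷ a₃ ∷ a₄ ∷ W ∷ ε ∷ [])

z-axis-relations : ∀ a₁ a₂ a₃ a₄ W ε →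
    a₁ * - (W * ε * a₄) ≡ a₂ * 0ℤ - a₄ * (W * a₁ * ε)
  × a₄ * 0ℤ ≡ a₃ * 0ℤ - a₁ * 0ℤ
  × a₁ * a₄ * - (W * ε * a₃) ≡ a₂ * a₃ * 0ℤ - a₃ * a₄ * (W * a₁ * ε) - a₁ * a₂ * 0ℤ
z-axis-relations a₁ a₂ a₃ a₄ W ε =
  solve (a₁ ∷ a₂ ∷ a₄ ∷ W ∷ ε ∷ []) , solve (a₁ ∷ a₃ ∷ a₄ ∷ []) , solve (a₁ ∷ a₂ ∷ a₃ ∷ a₄ ∷ W ∷ ε ∷ [])

xyz≡z[yx] : ∀ x y z → x * y * z ≡ z * (y * x)
xyz≡z[yx] x y z = solve (x ∷ y ∷ z ∷ [])

xyz≡y[zx] : ∀ x y z → x * y * z ≡ y * (z * x)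
xyz≡y[zx] x y z = solve (x ∷ y ∷ z ∷ [])

i∣0 : ∀ {k} → k ∣ₛ 0ℤ
i∣0 = divides 0ℤ refl

i-j*0≡i : ∀ i j → i - j * 0ℤ ≡ i
i-j*0≡i i j = solve (i ∷ j ∷ [])

i*j≡k*0-l*m⇒i*-j≡l*m : ∀ A u B C v → A * u ≡ B * 0ℤ - C * v → A * - u ≡ C * v
i*j≡k*0-l*m⇒i*-j≡l*m A u B C v eq = begin
  A * - u             ≡⟨ solve (A ∷ u ∷ []) ⟩
  - (A * u)           ≡⟨ cong -_ eq ⟩
  - (B * 0ℤ - C * v)  ≡⟨ solve (B ∷ C ∷ v ∷ []) ⟩
  C * v               ∎

pos-*-∣ : ∀ c {L w} → + L ∣ₛ w → + (c ℕ.* L) ∣ₛ + c * w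
pos-*-∣ c {L} {w} L∣w = subst (_∣ₛ + c * w) (sym (pos-* c L)) (Signed.*-monoʳ-∣ (+ c) L∣w)

i≡j-k⇒k≡j-i : ∀ {A B C} → A ≡ B - C → C ≡ B - A
i≡j-k⇒k≡j-i {A} {B} {C} A≡B-C = begin
  C           ≡⟨ solve (B ∷ C ∷ []) ⟩
  B - (B - C) ≡⟨ cong (_-_ B) (sym A≡B-C) ⟩
  B - A       ∎

module Setting
  (a : Fin 4 → ℤ) (d e : Fin 4 → ℕ)
  (a≢0 : ∀ i → a i ≢ + 0)
  (gcd[a,a]≡1 : ∀ i j → i ≢ j → gcd (a i) (a j) ≡ + 1)
  (d≢0 : ∀ i → d i ≢ 0) (e≢0 : ∀ i → e i ≢ 0)
  (gcd[d,a]≡1 : ∀ i j → i ≢ j → gcd (+ d i) (a j) ≡ + 1)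
  (e∣a : ∀ i → + e i ∣ a i)
  where

  𝒢ₛ : ℤ → ℤ → ℤ → Set
  𝒢ₛ = 𝒢 _∣ₛ_ a d e

  D E : Fin 4 → ℤ
  D i = + d i
  E i = + e i

  E∣a : ∀ i → E i ∣ₛ a i
  E∣a i = Signed.∣ᵤ⇒∣ {E i} {a i} (e∣a i)

  a⊥a : ∀ i j → i ≢ j → Comaximal (a i) (a j)
  a⊥a i j i≢j = gcd≡1⇒comaximal (a i) (a j) (gcd[a,a]≡1 i j i≢j)

  d⊥a : ∀ i j → i ≢ j → Comaximal (D i) (a j)
  d⊥a i j i≢j = gcd≡1⇒comaximal (D i) (a j) (gcd[d,a]≡1 i j i≢j)

  e⊥a : ∀ i j → i ≢ j → Comaximal (E i) (a j)
  e⊥a i j i≢j = comaximal-∣ˡ (E∣a i) (a⊥a i j i≢j)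

  d⊥e : ∀ i j → i ≢ j → Comaximal (D i) (E j)
  d⊥e i j i≢j = comaximal-∣ʳ (E∣a j) (d⊥a i j i≢j)

  d∣-cancel : ∀ {i} j k w → i ≢ j → i ≢ k → D i ∣ₛ a j * (E k * w) → D i ∣ₛ w
  d∣-cancel {i} j k w i≢j i≢k h = comaximal-divisor (d⊥e i k i≢k) (comaximal-divisor (d⊥a i j i≢j) h)

  f∣⇒dᵢ∣ : ∀ {i j k l x} → f d e i j k l ∣ₛ x → D i ∣ₛ x
  f∣⇒dᵢ∣ {i} {j} {k} {l} = Signed.∣-trans (pos-∣ (m∣lcm[m,n]*p*q (d i) (d j) (e k) (e l)))

  f∣⇒dⱼ∣ : ∀ {i j k l x} → f d e i j k l ∣ₛ x → D j ∣ₛ x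
  f∣⇒dⱼ∣ {i} {j} {k} {l} = Signed.∣-trans (pos-∣ (n∣lcm[m,n]*p*q (d i) (d j) (e k) (e l)))

  f∣⇒eₖ∣ : ∀ {i j k l x} → f d e i j k l ∣ₛ x → E k ∣ₛ x
  f∣⇒eₖ∣ {i} {j} {k} {l} = Signed.∣-trans (pos-∣ (p∣lcm[m,n]*p*q (d i) (d j) (e k) (e l)))

  f∣⇒eₗ∣ : ∀ {i j k l x} → f d e i j k l ∣ₛ x → E l ∣ₛ x
  f∣⇒eₗ∣ {i} {j} {k} {l} = Signed.∣-trans (pos-∣ (q∣lcm[m,n]*p*q (d i) (d j) (e k) (e l)))

  x-axis : ∀ {W} → D 0F ∣ₛ W → D 1F ∣ₛ W → D 3F ∣ₛ W → 𝒢ₛ (W * E 2F * a 3F) 0ℤ 0ℤ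
  x-axis {W} d₁∣W d₂∣W d₄∣W =
    let eq₁ , eq₂ , eq₃ = x-axis-relations (a 0F) (a 1F) (a 2F) (a 3F) W (E 2F) in
    0ℤ , - (W * a 0F * E 2F) , - (W * a 1F * E 2F) , eq₁ , eq₂ , eq₃ ,
    lcm*-∣ d₁∣W d₂∣W Signed.∣-refl (E∣a 3F) , i∣0 , i∣0 , i∣0 ,
    Signed.∣m⇒∣-m (lcm*-∣ d₂∣W d₄∣W (E∣a 0F) Signed.∣-refl) ,
    Signed.∣m⇒∣-m (lcm*-∣ d₁∣W d₄∣W (E∣a 1F) Signed.∣-refl)

  xy-plane : ∀ {W} → D 0F ∣ₛ W → D 1F ∣ₛ W → D 2F ∣ₛ W → 𝒢ₛ (W * a 2F * E 3F) (W * a 0F * E 3F) 0ℤ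
  xy-plane {W} d₁∣W d₂∣W d₃∣W =
    let eq₁ , eq₂ , eq₃ = xy-plane-relations (a 0F) (a 1F) (a 2F) (a 3F) W (E 3F) in
    W * a 1F * E 3F , 0ℤ , 0ℤ , eq₁ , eq₂ , eq₃ ,
    lcm*-∣ d₁∣W d₂∣W (E∣a 2F) Signed.∣-refl , lcm*-∣ d₂∣W d₃∣W (E∣a 0F) Signed.∣-refl , i∣0 ,
    lcm*-∣ d₁∣W d₃∣W (E∣a 1F) Signed.∣-refl , i∣0 , i∣0

  yz-plane : ∀ {W} → D 1F ∣ₛ W → D 2F ∣ₛ W → D 3F ∣ₛ W → 𝒢ₛ 0ℤ (W * E 0F * a 3F) (W * E 0F * a 1F)
  yz-plane {W} d₂∣W d₃∣W d₄∣W =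
    let eq₁ , eq₂ , eq₃ = yz-plane-relations (a 0F) (a 1F) (a 2F) (a 3F) W (E 0F) in
    0ℤ , W * E 0F * a 2F , 0ℤ , eq₁ , eq₂ , eq₃ ,
    i∣0 , lcm*-∣ d₂∣W d₃∣W Signed.∣-refl (E∣a 3F) , lcm*-∣ d₃∣W d₄∣W Signed.∣-refl (E∣a 1F) ,
    i∣0 , lcm*-∣ d₂∣W d₄∣W Signed.∣-refl (E∣a 2F) , i∣0

  z-axis : ∀ {W} → D 0F ∣ₛ W → D 2F ∣ₛ W → D 3F ∣ₛ W → 𝒢ₛ 0ℤ 0ℤ (W * a 0F * E 1F)
  z-axis {W} d₁∣W d₃∣W d₄∣W =
    let eq₁ , eq₂ , eq₃ = z-axis-relations (a 0F) (a 1F) (a 2F) (a 3F) W (E 1F) in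
    - (W * E 1F * a 3F) , 0ℤ , - (W * E 1F * a 2F) , eq₁ , eq₂ , eq₃ ,
    i∣0 , i∣0 , lcm*-∣ d₃∣W d₄∣W (E∣a 0F) Signed.∣-refl ,
    Signed.∣m⇒∣-m (lcm*-∣ d₁∣W d₃∣W Signed.∣-refl (E∣a 3F)) , i∣0 ,
    Signed.∣m⇒∣-m (lcm*-∣ d₁∣W d₄∣W Signed.∣-refl (E∣a 2F))

  g : ℕ
  g = ℕG.gcd (d 2F) (d 3F)

  instance
    g-nonZero : ℕ.NonZero g
    g-nonZero = ℕ.≢-nonZero (ℕG.gcd[m,n]≢0 (d 2F) (d 3F) (inj₁ (d≢0 2F)))

  M : ℕ
  M = lcm (lcm (d 0F) (d 1F)) g

  b₁₂∣ : ∀ {x y z} → 𝒢ₛ x y z → b12 d e ∣ₛ x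
  b₁₂∣ {x} {y} (_ , a24 , _ , _ , eq₂ , _ , divides q x≡q*f₁₂ , f₂₃∣y , _ , _ , f₂₄∣a24 , _) =
    subst₂ _∣ₛ_ (sym (pos-* (e 2F ℕ.* e 3F) M)) (sym x≡cw) (Signed.*-monoʳ-∣ c (lcm-least-pos L∣w g∣w))
    where
    L : ℕ
    L = lcm (d 0F) (d 1F)
    c w : ℤ
    c = + (e 2F ℕ.* e 3F)
    w = q * + L
    L∣w : + L ∣ₛ w
    L∣w = divides q refl
    x≡cw : x ≡ c * w
    x≡cw = begin
      x                                   ≡⟨ x≡q*f₁₂ ⟩
      q * + (L ℕ.* e 2F ℕ.* e 3F)         ≡⟨ cong (λ n → q * + n) (ℕP.*-assoc L (e 2F) (e 3F)) ⟩
      q * + (L ℕ.* (e 2F ℕ.* e 3F))       ≡⟨ cong (q *_) (pos-* L (e 2F ℕ.* e 3F)) ⟩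
      q * (+ L * c)                       ≡⟨ rearrange q (+ L) c ⟩
      c * w                               ∎
      where
      rearrange : ∀ q l c → q * (l * c) ≡ c * (q * l)
      rearrange q l c = solve (q ∷ l ∷ c ∷ [])
    g∣d₃ : + g ∣ₛ D 2F
    g∣d₃ = pos-∣ (ℕG.gcd[m,n]∣m (d 2F) (d 3F))
    g∣d₄ : + g ∣ₛ D 3F
    g∣d₄ = pos-∣ (ℕG.gcd[m,n]∣n (d 2F) (d 3F))
    g∣a₁x : + g ∣ₛ a 0F * x
    g∣a₁x = subst (+ g ∣ₛ_) (sym (i≡j-k⇒k≡j-i {B = a 2F * y} eq₂))
      (Signed.∣m∣n⇒∣m-n (Signed.∣n⇒∣m*n (a 2F) (Signed.∣-trans g∣d₃ (f∣⇒dⱼ∣ f₂₃∣y)))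
                    (Signed.∣n⇒∣m*n (a 3F) (Signed.∣-trans g∣d₄ (f∣⇒dⱼ∣ f₂₄∣a24))))
    g⊥a₁c : Comaximal (+ g) (a 0F * c)
    g⊥a₁c = comaximal-*ʳ (comaximal-∣ˡ g∣d₃ (d⊥a 2F 0F (λ ())))
      (subst (Comaximal (+ g)) (sym (pos-* (e 2F) (e 3F)))
        (comaximal-*ʳ (comaximal-∣ˡ g∣d₄ (d⊥e 3F 2F (λ ()))) (comaximal-∣ˡ g∣d₃ (d⊥e 2F 3F (λ ())))))
    g∣w : + g ∣ₛ w
    g∣w = comaximal-divisor g⊥a₁c
      (subst (+ g ∣ₛ_) (trans (cong (a 0F *_) x≡cw) (sym (*-assoc (a 0F) c w))) g∣a₁x)

  a₄b₂₃∣ : ∀ {y z} → 𝒢ₛ 0ℤ y z → a 3F * b23 d e ∣ₛ y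
  a₄b₂₃∣ {y} (_ , a24 , _ , _ , eq₂ , _ , _ , f₂₃∣y , _ , _ , f₂₄∣a24 , _) =
    conclude (comaximal-cross {u = a24} {y} {{≢-nonZero (a≢0 3F)}} (trans eq₂ (i-j*0≡i (a 2F * y) (a 0F)))
                (a⊥a 3F 2F (λ ())) (e⊥a 0F 3F (λ ())) (f∣⇒eₖ∣ f₂₃∣y))
    where
    conclude : (Σ ℤ λ w → y ≡ a 3F * (E 0F * w) × a24 ≡ a 2F * (E 0F * w)) → a 3F * b23 d e ∣ₛ y
    conclude (w , y≡ , a24≡) = subst (a 3F * b23 d e ∣ₛ_) (sym y≡) (Signed.*-monoʳ-∣ (a 3F) (pos-*-∣ (e 0F) L∣w))
      where
      L∣w : + lcm (lcm (d 1F) (d 2F)) (d 3F) ∣ₛ w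
      L∣w = lcm-least-pos
        (lcm-least-pos (d∣-cancel 3F 0F w (λ ()) (λ ()) (subst (D 1F ∣ₛ_) y≡ (f∣⇒dᵢ∣ f₂₃∣y)))
                       (d∣-cancel 3F 0F w (λ ()) (λ ()) (subst (D 2F ∣ₛ_) y≡ (f∣⇒dⱼ∣ f₂₃∣y))))
        (d∣-cancel 2F 0F w (λ ()) (λ ()) (subst (D 3F ∣ₛ_) a24≡ (f∣⇒dⱼ∣ f₂₄∣a24)))

  a₁b₃₄∣ : ∀ {z} → 𝒢ₛ 0ℤ 0ℤ z → a 0F * b34 d e ∣ₛ z
  a₁b₃₄∣ {z} (a13 , _ , _ , eq₁ , _ , _ , _ , _ , f₃₄∣z , f₁₃∣a13 , _ , _) =
    conclude (comaximal-cross {u = - a13} {z} {{≢-nonZero (a≢0 0F)}}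
                (i*j≡k*0-l*m⇒i*-j≡l*m (a 0F) a13 (a 1F) (a 3F) z eq₁)
                (a⊥a 0F 3F (λ ())) (e⊥a 1F 0F (λ ())) (f∣⇒eₗ∣ f₃₄∣z))
    where
    conclude : (Σ ℤ λ w → z ≡ a 0F * (E 1F * w) × - a13 ≡ a 3F * (E 1F * w)) → a 0F * b34 d e ∣ₛ z
    conclude (w , z≡ , -a13≡) = subst (a 0F * b34 d e ∣ₛ_) (sym z≡) (Signed.*-monoʳ-∣ (a 0F) (pos-*-∣ (e 1F) L∣w))
      where
      L∣w : + lcm (lcm (d 0F) (d 2F)) (d 3F) ∣ₛ w
      L∣w = lcm-least-pos
        (lcm-least-pos (d∣-cancel 3F 1F w (λ ()) (λ ()) (subst (D 0F ∣ₛ_) -a13≡ (Signed.∣m⇒∣-m (f∣⇒dᵢ∣ f₁₃∣a13))))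
                       (d∣-cancel 0F 1F w (λ ()) (λ ()) (subst (D 2F ∣ₛ_) z≡ (f∣⇒dᵢ∣ f₃₄∣z))))
        (d∣-cancel 0F 1F w (λ ()) (λ ()) (subst (D 3F ∣ₛ_) z≡ (f∣⇒dⱼ∣ f₃₄∣z)))

  v₂ : 𝒢ₛ 0ℤ (a 3F * b23 d e) (+ lcm (lcm (d 1F) (d 2F)) (d 3F) * E 0F * a 1F)
  v₂ = 𝒢ₛ-resp a d e refl y≡ refl
         (yz-plane (pos-∣ (m∣lcm₃ (d 1F) (d 2F) (d 3F))) (pos-∣ (n∣lcm₃ (d 1F) (d 2F) (d 3F)))
                   (pos-∣ (o∣lcm₃ (d 1F) (d 2F) (d 3F))))
    where
    L : ℕ
    L = lcm (lcm (d 1F) (d 2F)) (d 3F)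
    y≡ : + L * E 0F * a 3F ≡ a 3F * b23 d e
    y≡ = trans (xyz≡z[yx] (+ L) (E 0F) (a 3F)) (cong (a 3F *_) (sym (pos-* (e 0F) L)))

  v₃ : 𝒢ₛ 0ℤ 0ℤ (a 0F * b34 d e)
  v₃ = 𝒢ₛ-resp a d e refl refl z≡
         (z-axis (pos-∣ (m∣lcm₃ (d 0F) (d 2F) (d 3F))) (pos-∣ (n∣lcm₃ (d 0F) (d 2F) (d 3F)))
                 (pos-∣ (o∣lcm₃ (d 0F) (d 2F) (d 3F))))
    where
    L : ℕ
    L = lcm (lcm (d 0F) (d 2F)) (d 3F)
    z≡ : + L * a 0F * E 1F ≡ a 0F * b34 d e
    z≡ = trans (xyz≡y[zx] (+ L) (a 0F) (E 1F)) (cong (a 0F *_) (sym (pos-* (e 1F) L)))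

  α : Fin 4 → ℤ
  α i = Signed.quotient (E∣a i)

  a≡αE : ∀ i → a i ≡ α i * E i
  a≡αE i = Signed._∣_.equality (E∣a i)

  α∣a : ∀ i → α i ∣ₛ a i
  α∣a i = divides (E i) (trans (a≡αE i) (*-comm (α i) (E i)))

  d₃′ d₄′ : ℕ
  d₃′ = d 2F ℕ./ g
  d₄′ = d 3F ℕ./ g

  d₃′∣d₃ : + d₃′ ∣ₛ D 2F
  d₃′∣d₃ = pos-∣ (ℕD.divides g (sym (m*[n/m]≡n (ℕG.gcd[m,n]∣m (d 2F) (d 3F)))))

  d₄′∣d₄ : + d₄′ ∣ₛ D 3F
  d₄′∣d₄ = pos-∣ (ℕD.divides g (sym (m*[n/m]≡n (ℕG.gcd[m,n]∣n (d 2F) (d 3F)))))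

  α₄d₄′⊥α₃d₃′ : Comaximal (α 3F * + d₄′) (α 2F * + d₃′)
  α₄d₄′⊥α₃d₃′ = comaximal-*ˡ
    (comaximal-*ʳ (comaximal-∣ˡ (α∣a 3F) (comaximal-∣ʳ (α∣a 2F) (a⊥a 3F 2F (λ ()))))
                  (comaximal-∣ˡ (α∣a 3F) (comaximal-∣ʳ d₃′∣d₃ (comaximal-sym (d⊥a 2F 3F (λ ()))))))
    (comaximal-*ʳ (comaximal-∣ˡ d₄′∣d₄ (comaximal-∣ʳ (α∣a 2F) (d⊥a 3F 2F (λ ()))))
                  (bézout⇒comaximal (ℕC.coprime-Bézout (ℕC.sym (ℕC.coprime-/gcd (d 2F) (d 3F))))))

  W₃ W₄ : ℤ
  W₃ = + (M ℕ.* d₃′)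
  W₄ = + (M ℕ.* d₄′)

  g∣M : g ℕD.∣ M
  g∣M = o∣lcm₃ (d 0F) (d 1F) g

  d₁∣W₄ : D 0F ∣ₛ W₄
  d₁∣W₄ = pos-∣ (ℕD.∣m⇒∣m*n d₄′ (m∣lcm₃ (d 0F) (d 1F) g))

  d₂∣W₄ : D 1F ∣ₛ W₄
  d₂∣W₄ = pos-∣ (ℕD.∣m⇒∣m*n d₄′ (n∣lcm₃ (d 0F) (d 1F) g))

  d₁∣W₃ : D 0F ∣ₛ W₃
  d₁∣W₃ = pos-∣ (ℕD.∣m⇒∣m*n d₃′ (m∣lcm₃ (d 0F) (d 1F) g))

  d₂∣W₃ : D 1F ∣ₛ W₃
  d₂∣W₃ = pos-∣ (ℕD.∣m⇒∣m*n d₃′ (n∣lcm₃ (d 0F) (d 1F) g))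

  d₄∣W₄ : D 3F ∣ₛ W₄
  d₄∣W₄ = pos-∣ (subst (ℕD._∣ M ℕ.* d₄′) (m*[n/m]≡n (ℕG.gcd[m,n]∣n (d 2F) (d 3F))) (ℕD.*-pres-∣ g∣M ℕD.∣-refl))

  d₃∣W₃ : D 2F ∣ₛ W₃
  d₃∣W₃ = pos-∣ (subst (ℕD._∣ M ℕ.* d₃′) (m*[n/m]≡n (ℕG.gcd[m,n]∣m (d 2F) (d 3F))) (ℕD.*-pres-∣ g∣M ℕD.∣-refl))

  bézout-x : ∀ r s → r * (α 3F * + d₄′) + s * (α 2F * + d₃′) ≡ 1ℤ →
             r * (W₄ * E 2F * a 3F) + s * (W₃ * a 2F * E 3F) ≡ b12 d e
  bézout-x r s rs≡1 = begin
    r * (W₄ * E 2F * a 3F) + s * (W₃ * a 2F * E 3F)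
      ≡⟨ cong₂ (λ u v → r * (u * E 2F * a 3F) + s * (v * a 2F * E 3F)) (pos-* M d₄′) (pos-* M d₃′) ⟩
    r * (+ M * + d₄′ * E 2F * a 3F) + s * (+ M * + d₃′ * a 2F * E 3F)
      ≡⟨ cong₂ (λ u v → r * (+ M * + d₄′ * E 2F * u) + s * (+ M * + d₃′ * v * E 3F)) (a≡αE 3F) (a≡αE 2F) ⟩
    r * (+ M * + d₄′ * E 2F * (α 3F * E 3F)) + s * (+ M * + d₃′ * (α 2F * E 2F) * E 3F)
      ≡⟨ factor r s (+ M) (+ d₄′) (+ d₃′) (E 2F) (E 3F) (α 3F) (α 2F) ⟩
    E 2F * E 3F * + M * (r * (α 3F * + d₄′) + s * (α 2F * + d₃′))
      ≡⟨ cong (E 2F * E 3F * + M *_) rs≡1 ⟩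
    E 2F * E 3F * + M * 1ℤ
      ≡⟨ *-identityʳ _ ⟩
    E 2F * E 3F * + M
      ≡⟨ sym (trans (pos-* (e 2F ℕ.* e 3F) M) (cong (_* + M) (pos-* (e 2F) (e 3F)))) ⟩
    b12 d e ∎
    where
    factor : ∀ r s m δ₄ δ₃ ε₃ ε₄ α₄ α₃ →
      r * (m * δ₄ * ε₃ * (α₄ * ε₄)) + s * (m * δ₃ * (α₃ * ε₃) * ε₄) ≡ ε₃ * ε₄ * m * (r * (α₄ * δ₄) + s * (α₃ * δ₃))
    factor r s m δ₄ δ₃ ε₃ ε₄ α₄ α₃ = solve (r ∷ s ∷ m ∷ δ₄ ∷ δ₃ ∷ ε₃ ∷ ε₄ ∷ α₄ ∷ α₃ ∷ [])

  v₁ : Σ ℤ λ y₁ → Σ ℤ λ z₁ → 𝒢ₛ (b12 d e) y₁ z₁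
  v₁ = combine α₄d₄′⊥α₃d₃′
    where
    combine : Comaximal (α 3F * + d₄′) (α 2F * + d₃′) → Σ ℤ λ y₁ → Σ ℤ λ z₁ → 𝒢ₛ (b12 d e) y₁ z₁
    combine (r , s , rs≡1) = _ , _ , 𝒢ₛ-resp a d e (bézout-x r s rs≡1) refl refl
      (𝒢ₛ-+ a d e (𝒢ₛ-* a d e r (x-axis d₁∣W₄ d₂∣W₄ d₄∣W₄)) (𝒢ₛ-* a d e s (xy-plane d₁∣W₃ d₂∣W₃ d₃∣W₃)))

  b₁₂≢0 : b12 d e ≢ 0ℤ
  b₁₂≢0 = pos≢0 (m*n≢0 (m*n≢0 (e≢0 2F) (e≢0 3F))
                       (lcm≢0 (lcm≢0 (d≢0 0F) (d≢0 1F)) (ℕG.gcd[m,n]≢0 (d 2F) (d 3F) (inj₁ (d≢0 2F)))))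

  a₄b₂₃≢0 : a 3F * b23 d e ≢ 0ℤ
  a₄b₂₃≢0 = i*j≢0 (a≢0 3F) (pos≢0 (m*n≢0 (e≢0 0F) (lcm≢0 (lcm≢0 (d≢0 1F) (d≢0 2F)) (d≢0 3F))))

  a₁b₃₄≢0 : a 0F * b34 d e ≢ 0ℤ
  a₁b₃₄≢0 = i*j≢0 (a≢0 0F) (pos≢0 (m*n≢0 (e≢0 1F) (lcm≢0 (lcm≢0 (d≢0 0F) (d≢0 2F)) (d≢0 3F))))

lemma4p2 : (a : Fin 4 → ℤ) (d e : Fin 4 → ℕ) →
  (∀ i → a i ≢ + 0) →
  (∀ i j → i ≢ j → gcd (a i) (a j) ≡ + 1) →
  (∀ i → d i ≢ 0) → (∀ i → e i ≢ 0) →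
  (∀ i j → i ≢ j → gcd (+ d i) (a j) ≡ + 1) →
  (∀ i → + e i ∣ a i) →
  ( InG a d e (+ 0) (+ 0) (+ 0)
  × (∀ x y z x′ y′ z′ → InG a d e x y z → InG a d e x′ y′ z′ →
       InG a d e (x + x′) (y + y′) (z + z′))
  × (∀ x y z → InG a d e x y z → InG a d e (- x) (- y) (- z))
  × Σ ℤ (λ x1 → Σ ℤ λ y1 → Σ ℤ λ z1 → Σ ℤ λ x2 → Σ ℤ λ y2 → Σ ℤ λ z2 →
      Σ ℤ λ x3 → Σ ℤ λ y3 → Σ ℤ λ z3 →
        InG a d e x1 y1 z1 × InG a d e x2 y2 z2 × InG a d e x3 y3 z3
        × det3 x1 y1 z1 x2 y2 z2 x3 y3 z3 ≢ + 0)
  × Σ (ℤ → ℤ) (λ γ23 → Σ (ℤ → ℤ → ℤ) λ γ34 →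
      ∀ a12 a23 a34 → InG a d e a12 a23 a34 ⇔
        ( (b12 d e ∣ a12)
        × (a 3F * b23 d e ∣ a23 - γ23 a12)
        × (a 0F * b34 d e ∣ a34 - γ34 a12 a23))))
lemma4p2 a d e a≢0 gcd[a,a]≡1 d≢0 e≢0 gcd[d,a]≡1 e∣a =
  from zero ,
  (λ x y z x′ y′ z′ p p′ → from (𝒢ₛ-+ a d e (to {x} {y} {z} p) (to {x′} {y′} {z′} p′))) ,
  (λ x y z p → from (𝒢ₛ-neg a d e (to {x} {y} {z} p))) ,
  (b12 d e , y₁ , z₁ , 0ℤ , a 3F * b23 d e , z₂ , 0ℤ , 0ℤ , a 0F * b34 d e , from u₁ , from v₂ , from v₃ ,
   det3-upper-triangular≢0 (b12 d e) y₁ z₁ (a 3F * b23 d e) z₂ (a 0F * b34 d e) b₁₂≢0 a₄b₂₃≢0 a₁b₃₄≢0) ,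
  (γ₂₃ , γ₃₄ , description)
  where
  open Setting a d e a≢0 gcd[a,a]≡1 d≢0 e≢0 gcd[d,a]≡1 e∣a
  y₁ z₁ z₂ : ℤ
  y₁ = proj₁ v₁
  z₁ = proj₁ (proj₂ v₁)
  z₂ = + lcm (lcm (d 1F) (d 2F)) (d 3F) * E 0F * a 1F
  u₁ : 𝒢ₛ (b12 d e) y₁ z₁
  u₁ = proj₂ (proj₂ v₁)
  -- 0ℤ * i reduces to 0ℤ, so 0 · v₃ is literally the zero vector.
  zero : 𝒢ₛ 0ℤ 0ℤ 0ℤ
  zero = 𝒢ₛ-* a d e 0ℤ v₃
  open Echelon 𝒢ₛ (𝒢ₛ-+ a d e) (𝒢ₛ-* a d e) u₁ v₂ v₃ b₁₂∣ a₄b₂₃∣ a₁b₃₄∣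
  to : ∀ {x y z} → InG a d e x y z → 𝒢ₛ x y z
  to = Equivalence.to (InG⇔𝒢ₛ a d e)
  from : ∀ {x y z} → 𝒢ₛ x y z → InG a d e x y z
  from = Equivalence.from (InG⇔𝒢ₛ a d e)
  description : ∀ x y z → InG a d e x y z ⇔
    ((b12 d e ∣ x) × (a 3F * b23 d e ∣ y - γ₂₃ x) × (a 0F * b34 d e ∣ z - γ₃₄ x y))
  description x y z = mk⇔ (λ p → Equivalence.to (congruences x y z) (to {x} {y} {z} p))
                          (λ h → from {x} {y} {z} (Equivalence.from (congruences x y z) h))
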